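{- Let the vertices of $C_5$ be $v_0,\dots,v_4$ (with $v_i$ adjacent to $v_{i\pm1\bmod 5}$), and let $B$ be the distribution on $C_5\Box C_5$ with one pebble on each vertex $(v_i,v_{2i\bmod 5})$, $0\le i\le 4$, and none elsewhere. Let $G$ be any graph, $t$ a positive integer, and $D$ a $t$-solvable distribution on $G$ in which the number of pebbles on every vertex is a multiple of four. Then $B\cdot D$ is a $t$-solvable distribution on $(C_5\Box C_5)\Box G$ in which the number of pebbles on every vertex is a multiple of four, and $|B\cdot D|=5|D|$. In particular, for every integer $m\ge 0$, $\pi_t^*(C_5^{2m}\Box G)\le 5^m|D|$.
   Context: Graphs are finite simple graphs. A distribution on a graph $G=(V,E)$ is a function $D:V\to\mathbb{N}$, with size $|D|=\sum_v D(v)$. A pebbling move removes two pebbles from a vertex having at least two pebbles and places one pebble on a neighbor. A distribution $D$ is $t$-solvable if for every vertex $v$, some sequence of pebbling moves starting from $D$ results in a distribution with at least $t$ pebbles on $v$. The optimal $t$-pebbling number $\pi_t^*(G)$ is the minimum size of a $t$-solvable distribution on $G$. $\Box$ denotes the Cartesian product of graphs and $H^k$ the $k$-fold Cartesian product of $H$ with itself. For distributions $D$ on $G$ and $D'$ on $G'$, $D\cdot D'$ is the distribution on $G\Box G'$ with $(D\cdot D')((x,x'))=D(x)D'(x')$. -}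

module Defs where

open import Data.Nat using (ℕ; zero; suc; _+_; _*_; _∸_; _^_; _≤_; _%_)
open import Data.Nat.Divisibility using (_∣_)
open import Data.Fin using (Fin; toℕ; remQuot; combine)
open import Data.Fin.Properties using ()
open import Data.Product using (Σ; ∃; _×_; _,_; proj₁; proj₂)
open import Data.Sum using (_⊎_; inj₁; inj₂)
open import Data.List using (List; map; allFin)
open import Data.Nat.ListAction using (sum)
open import Data.Bool using (if_then_else_)
open import Relation.Nullary using (¬_)
open import Relation.Nullary.Decidable using (⌊_⌋)
open import Relation.Binary.PropositionalEquality using (_≡_; _≢_; refl; sym)
open import Relation.Binary.Construct.Closure.ReflexiveTransitive using (Star)

record Graph : Set₁ where
  field
    n      : ℕ
    Adj    : Fin n → Fin n → Set
    Adj-sym    : ∀ {u v} → Adj u v → Adj v u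
    Adj-irrefl : ∀ {u} → ¬ Adj u u
open Graph public

Distribution : Graph → Set
Distribution G = Fin (n G) → ℕ

size : (G : Graph) → Distribution G → ℕ
size G D = sum (map D (allFin (n G)))

Move : (G : Graph) → Distribution G → Distribution G → Set
Move G D D' =
  Σ (Fin (n G)) λ u → Σ (Fin (n G)) λ w →
    Adj G u w × 2 ≤ D u ×
    D' u ≡ D u ∸ 2 × D' w ≡ suc (D w) ×
    (∀ x → x ≢ u → x ≢ w → D' x ≡ D x)

Reachable : (G : Graph) → Distribution G → Distribution G → Set
Reachable G = Star (Move G)

Solvable : (G : Graph) → ℕ → Distribution G → Set
Solvable G t D = ∀ v → Σ (Distribution G) λ D' → Reachable G D D' × t ≤ D' v

IsOptimalPebblingNumber : Graph → ℕ → ℕ → Set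
IsOptimalPebblingNumber G t k =
  (Σ (Distribution G) λ D → Solvable G t D × size G D ≡ k) ×
  (∀ D → Solvable G t D → k ≤ size G D)

-- Cartesian product. The vertex (a , b) of G □ H is encoded as
-- combine a b : Fin (n G * n H); remQuot decodes it.

_□_ : Graph → Graph → Graph
G □ H = record
  { n = n G * n H
  ; Adj = λ i j → PAdj (remQuot {n G} (n H) i) (remQuot {n G} (n H) j)
  ; Adj-sym = λ {i} {j} → psym (remQuot {n G} (n H) i) (remQuot {n G} (n H) j)
  ; Adj-irrefl = λ {i} → pirr (remQuot {n G} (n H) i)
  }
  where
  PAdj : Fin (n G) × Fin (n H) → Fin (n G) × Fin (n H) → Set
  PAdj (a , b) (c , d) = (a ≡ c × Adj H b d) ⊎ (Adj G a c × b ≡ d)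
  psym : ∀ p q → PAdj p q → PAdj q p
  psym (a , b) (c , d) (inj₁ (e , h)) = inj₁ (sym e , Adj-sym H h)
  psym (a , b) (c , d) (inj₂ (h , e)) = inj₂ (Adj-sym G h , sym e)
  pirr : ∀ p → ¬ PAdj p p
  pirr (a , b) (inj₁ (_ , h)) = Adj-irrefl H h
  pirr (a , b) (inj₂ (h , _)) = Adj-irrefl G h

infixr 6 _□_

_·_ : {G H : Graph} → Distribution G → Distribution H → Distribution (G □ H)
_·_ {G} {H} D D' i = D (proj₁ (remQuot {n G} (n H) i)) * D' (proj₂ (remQuot {n G} (n H) i))

powBox : Graph → ℕ → Graph → Graph
powBox H zero    G = G
powBox H (suc k) G = H □ powBox H k G

C5 : Graph
C5 = record
  { n = 5
  ; Adj = A
  ; Adj-sym = λ { (inj₁ e) → inj₂ e ; (inj₂ e) → inj₁ e }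
  ; Adj-irrefl = irr
  }
  where
  A : Fin 5 → Fin 5 → Set
  A i j = toℕ j ≡ (toℕ i + 1) % 5 ⊎ toℕ i ≡ (toℕ j + 1) % 5
  irr : ∀ {u} → ¬ A u u
  irr {Fin.zero} (inj₁ ())
  irr {Fin.zero} (inj₂ ())
  irr {Fin.suc Fin.zero} (inj₁ ())
  irr {Fin.suc Fin.zero} (inj₂ ())
  irr {Fin.suc (Fin.suc Fin.zero)} (inj₁ ())
  irr {Fin.suc (Fin.suc Fin.zero)} (inj₂ ())
  irr {Fin.suc (Fin.suc (Fin.suc Fin.zero))} (inj₁ ())
  irr {Fin.suc (Fin.suc (Fin.suc Fin.zero))} (inj₂ ())
  irr {Fin.suc (Fin.suc (Fin.suc (Fin.suc Fin.zero)))} (inj₁ ())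
  irr {Fin.suc (Fin.suc (Fin.suc (Fin.suc Fin.zero)))} (inj₂ ())

C5²  : Graph
C5² = C5 □ C5

B : Distribution C5²
B p = if ⌊ toℕ (proj₂ (remQuot {5} 5 p)) Data.Nat.≟ (2 * toℕ (proj₁ (remQuot {5} 5 p))) % 5 ⌋
        then 1 else 0

AllMult4 : (G : Graph) → Distribution G → Set
AllMult4 G D = ∀ v → 4 ∣ D v

module Submission where

-- In C5², every vertex c outside B has a B-neighbour b₁ and two further B-vertices b₂, b₃ at
-- distance two (through m₂, m₃), so 4j pebbles on each vertex of B can put 2j + j + j = 4j
-- pebbles on c. In B · D the copy of C5² over x carries D(x) · B with 4 ∣ D(x); gathering
-- fibre by fibre fills the copy {c} × G with D, where the pebbling of D in G is replayed.
-- Powers follow by induction through (C5 □ C5) □ X ≅ C5 □ (C5 □ X).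

open import Defs
open import Data.Nat as ℕ using (ℕ; zero; suc; _+_; _*_; _∸_; _^_; _≤_; s≤s; _%_)
open import Data.Nat.Divisibility using (_∣_; divides; ∣n⇒∣m*n)
open import Data.Nat.Properties
open import Data.Fin using (Fin; zero; suc; toℕ; #_; combine; remQuot; _↑ˡ_; _↑ʳ_) renaming (_≟_ to _≟ᶠ_)
open import Data.Fin.Properties using (remQuot-combine; combine-remQuot; combine-injectiveˡ; combine-injectiveʳ; all?)
open import Data.Product using (Σ-syntax; _×_; _,_; proj₁; proj₂)
open import Data.Sum using (_⊎_; inj₁; inj₂)
open import Data.List using (List; []; _∷_; allFin; map; tabulate)
open import Data.List.Membership.Propositional using (_∈_; _∉_)
open import Data.List.Membership.Propositional.Properties using (∈-allFin; ∈-map⁻)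
open import Data.List.Membership.DecPropositional {A = Fin 25} _≟ᶠ_ using (_∈?_)
open import Data.List.Relation.Unary.Any using (here; there)
open import Data.List.Relation.Unary.All as All using (All)
open import Data.List.Relation.Unary.All.Properties using (All¬⇒¬Any)
open import Data.List.Relation.Unary.Unique.Propositional using (Unique; []; _∷_)
open import Data.List.Relation.Unary.Unique.Propositional.Properties using (allFin⁺)
open import Data.Nat.ListAction as List using ()
open import Algebra.Properties.Semiring.Sum +-*-semiring
  using (sum; sum-syntax; sum-cong-≗; sum-permute; *-distribˡ-sum; *-distribʳ-sum)
open import Data.Fin.Permutation using (Permutation; permutation; _⟨$⟩ʳ_; _⟨$⟩ˡ_; inverseˡ; inverseʳ; flip)
open import Function using (_∘_)
open import Function.Definitions using (Injective)
open import Relation.Nullary using (Dec; yes; no; ¬?; _×-dec_; _⊎-dec_)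
open import Relation.Nullary.Decidable using (from-yes)
open import Relation.Nullary.Negation using (contradiction)
open import Relation.Binary.PropositionalEquality
open import Relation.Binary.Construct.Closure.ReflexiveTransitive using (ε; _◅_; _◅◅_)

module Moves (G : Graph) where

  move : Distribution G → Fin (n G) → Fin (n G) → Distribution G
  move E u w q with q ≟ᶠ u | q ≟ᶠ w
  ... | yes _ | _     = E q ∸ 2
  ... | no _  | yes _ = suc (E q)
  ... | no _  | no _  = E q

  move-source : ∀ E u w → move E u w u ≡ E u ∸ 2
  move-source E u w with u ≟ᶠ u
  ... | yes _   = refl
  ... | no u≢u  = contradiction refl u≢u

  move-target : ∀ E {u w} → u ≢ w → move E u w w ≡ suc (E w)
  move-target E {u} {w} u≢w with w ≟ᶠ u | w ≟ᶠ w
  ... | yes w≡u | _      = contradiction (sym w≡u) u≢w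
  ... | no _    | yes _  = refl
  ... | no _    | no w≢w = contradiction refl w≢w

  move-other : ∀ E {u w q} → q ≢ u → q ≢ w → move E u w q ≡ E q
  move-other E {u} {w} {q} q≢u q≢w with q ≟ᶠ u | q ≟ᶠ w
  ... | yes q≡u | _       = contradiction q≡u q≢u
  ... | no _    | yes q≡w = contradiction q≡w q≢w
  ... | no _    | no _    = refl

  move-nondecreasing : ∀ E {u w q} → q ≢ u → E q ≤ move E u w q
  move-nondecreasing E {u} {w} {q} q≢u with q ≟ᶠ u | q ≟ᶠ w
  ... | yes q≡u | _     = contradiction q≡u q≢u
  ... | no _    | yes _ = n≤1+n (E q)
  ... | no _    | no _  = ≤-refl

  Adj⇒≢ : ∀ {u w} → Adj G u w → u ≢ w
  Adj⇒≢ u~w refl = Adj-irrefl G u~w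

  move-Move : ∀ E {u w} → Adj G u w → 2 ≤ E u → Move G E (move E u w)
  move-Move E {u} {w} u~w 2≤Eu =
    u , w , u~w , 2≤Eu , move-source E u w , move-target E (Adj⇒≢ u~w) ,
    λ _ q≢u q≢w → move-other E q≢u q≢w

  Sends : ℕ → Distribution G → Fin (n G) → Fin (n G) → Set
  Sends k E u w =
    Σ[ E' ∈ Distribution G ] Reachable G E E' × k + E w ≤ E' w × (∀ q → q ≢ u → E q ≤ E' q)

  moves-along : ∀ k {E u w} → Adj G u w → 2 * k ≤ E u → Sends k E u w
  moves-along zero {E} _ _ = E , ε , ≤-refl , λ _ _ → ≤-refl
  moves-along (suc k) {E} {u} {w} u~w 2k+2≤Eu = after-move (moves-along k u~w 2k≤E₁u)
    where
    E₁ = move E u w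
    2+2k≤Eu : 2 + 2 * k ≤ E u
    2+2k≤Eu = subst (_≤ E u) (*-suc 2 k) 2k+2≤Eu
    2k≤E₁u : 2 * k ≤ E₁ u
    2k≤E₁u = subst (2 * k ≤_) (sym (move-source E u w)) (∸-monoˡ-≤ 2 2+2k≤Eu)
    after-move : Sends k E₁ u w → Sends (suc k) E u w
    after-move (E' , E₁⇝E' , gain , kept) =
      E' , move-Move E u~w (≤-trans (m≤m+n 2 (2 * k)) 2+2k≤Eu) ◅ E₁⇝E' ,
      subst (_≤ E' w) (trans (cong (k +_) (move-target E (Adj⇒≢ u~w))) (+-suc k (E w))) gain ,
      λ q q≢u → ≤-trans (move-nondecreasing E q≢u) (kept q q≢u)

  moves-along₂ : ∀ k {E u m w} → Adj G u m → Adj G m w → w ≢ u → 4 * k ≤ E u →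
    Σ[ E' ∈ Distribution G ] Reachable G E E' × k + E w ≤ E' w × (∀ q → q ≢ u → q ≢ m → E q ≤ E' q)
  moves-along₂ k {E} {u} {m} {w} u~m m~w w≢u 4k≤Eu
    with E₁ , E⇝E₁ , gain₁ , kept₁ ← moves-along (2 * k) u~m (subst (_≤ E u) (*-assoc 2 2 k) 4k≤Eu)
    with E₂ , E₁⇝E₂ , gain₂ , kept₂ ← moves-along k {E₁} m~w (≤-trans (m≤m+n (2 * k) (E m)) gain₁) =
    E₂ , E⇝E₁ ◅◅ E₁⇝E₂ ,
    ≤-trans (+-monoʳ-≤ k (kept₁ w w≢u)) gain₂ ,
    λ q q≢u q≢m → ≤-trans (kept₁ q q≢u) (kept₂ q q≢m)

  IsFunnel : (c b₁ b₂ m₂ b₃ m₃ : Fin (n G)) → Set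
  IsFunnel c b₁ b₂ m₂ b₃ m₃ =
    Adj G b₁ c × Adj G b₂ m₂ × Adj G m₂ c × Adj G b₃ m₃ × Adj G m₃ c ×
    b₂ ≢ b₁ × b₃ ≢ b₁ × b₃ ≢ b₂ × b₃ ≢ m₂ × c ≢ b₂ × c ≢ b₃

  isFunnel? : (∀ u w → Dec (Adj G u w)) → ∀ c b₁ b₂ m₂ b₃ m₃ → Dec (IsFunnel c b₁ b₂ m₂ b₃ m₃)
  isFunnel? adj? c b₁ b₂ m₂ b₃ m₃ =
    adj? b₁ c ×-dec adj? b₂ m₂ ×-dec adj? m₂ c ×-dec adj? b₃ m₃ ×-dec adj? m₃ c ×-dec
    ¬? (b₂ ≟ᶠ b₁) ×-dec ¬? (b₃ ≟ᶠ b₁) ×-dec ¬? (b₃ ≟ᶠ b₂) ×-dec ¬? (b₃ ≟ᶠ m₂) ×-dec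
    ¬? (c ≟ᶠ b₂) ×-dec ¬? (c ≟ᶠ b₃)

  funnel-gathers : ∀ j {E c b₁ b₂ m₂ b₃ m₃} → IsFunnel c b₁ b₂ m₂ b₃ m₃ →
    4 * j ≤ E b₁ → 4 * j ≤ E b₂ → 4 * j ≤ E b₃ →
    Σ[ E' ∈ Distribution G ] Reachable G E E' × 4 * j ≤ E' c
  funnel-gathers j {E} {c} {b₁} {b₂} {m₂} {b₃} {m₃}
    (b₁~c , b₂~m₂ , m₂~c , b₃~m₃ , m₃~c , b₂≢b₁ , b₃≢b₁ , b₃≢b₂ , b₃≢m₂ , c≢b₂ , c≢b₃) h₁ h₂ h₃
    with E₁ , E⇝E₁ , gain₁ , kept₁ ← moves-along (2 * j) b₁~c (subst (_≤ E b₁) (*-assoc 2 2 j) h₁)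
    with E₂ , E₁⇝E₂ , gain₂ , kept₂ ← moves-along₂ j b₂~m₂ m₂~c c≢b₂ (≤-trans h₂ (kept₁ b₂ b₂≢b₁))
    with E₃ , E₂⇝E₃ , gain₃ , _     ← moves-along₂ j b₃~m₃ m₃~c c≢b₃
                                        (≤-trans h₃ (≤-trans (kept₁ b₃ b₃≢b₁) (kept₂ b₃ b₃≢b₂ b₃≢m₂))) =
    E₃ , E⇝E₁ ◅◅ E₁⇝E₂ ◅◅ E₂⇝E₃ , 4j≤E₃c
    where
    open ≤-Reasoning
    4j≤E₃c : 4 * j ≤ E₃ c
    4j≤E₃c = begin
      j + (j + 2 * j)  ≤⟨ +-monoʳ-≤ j (+-monoʳ-≤ j (≤-trans (m≤m+n (2 * j) (E c)) gain₁)) ⟩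
      j + (j + E₁ c)   ≤⟨ +-monoʳ-≤ j gain₂ ⟩
      j + E₂ c         ≤⟨ gain₃ ⟩
      E₃ c             ∎

record Embedding (G P : Graph) : Set where
  field
    embed           : Fin (n G) → Fin (n P)
    embed-injective : Injective _≡_ _≡_ embed
    embed-Adj       : ∀ {x y} → Adj G x y → Adj P (embed x) (embed y)

module Lift {G P : Graph} (e : Embedding G P) where
  open Embedding e
  open Moves P using (move; move-source; move-target; move-other; move-Move; Adj⇒≢)

  _⊑_∘embed : Distribution G → Distribution P → Set
  D ⊑ E ∘embed = ∀ x → D x ≤ E (embed x)

  OffImage : Fin (n P) → Set
  OffImage q = ∀ x → embed x ≢ q

  lift-Move : ∀ {D D' E} → Move G D D' → D ⊑ E ∘embed →
    Σ[ E' ∈ Distribution P ] Move P E E' × D' ⊑ E' ∘embed × (∀ q → OffImage q → E q ≤ E' q)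
  lift-Move {D} {D'} {E} (u , w , u~w , 2≤Du , D'u , D'w , D'-other) D⊑E =
    E' ,
    move-Move E (embed-Adj u~w) (≤-trans 2≤Du (D⊑E u)) ,
    D'⊑E' ,
    λ q off → ≤-reflexive (sym (move-other E (λ q≡ → off u (sym q≡)) (λ q≡ → off w (sym q≡))))
    where
    E' = move E (embed u) (embed w)
    D'⊑E' : D' ⊑ E' ∘embed
    D'⊑E' x with x ≟ᶠ u | x ≟ᶠ w
    ... | yes refl | _ = subst₂ _≤_ (sym D'u) (sym (move-source E (embed u) (embed w))) (∸-monoˡ-≤ 2 (D⊑E u))
    ... | no _ | yes refl =
      subst₂ _≤_ (sym D'w) (sym (move-target E (Adj⇒≢ (embed-Adj u~w)))) (s≤s (D⊑E w))
    ... | no x≢u | no x≢w =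
      subst₂ _≤_ (sym (D'-other x x≢u x≢w))
        (sym (move-other E (x≢u ∘ embed-injective) (x≢w ∘ embed-injective))) (D⊑E x)

  lift-Reachable : ∀ {D D' E} → Reachable G D D' → D ⊑ E ∘embed →
    Σ[ E' ∈ Distribution P ] Reachable P E E' × D' ⊑ E' ∘embed × (∀ q → OffImage q → E q ≤ E' q)
  lift-Reachable {E = E} ε D⊑E = E , ε , D⊑E , λ _ _ → ≤-refl
  lift-Reachable (D⇒D₁ ◅ D₁⇝D') D⊑E
    with E₁ , E⇒E₁ , D₁⊑E₁ , kept₁ ← lift-Move D⇒D₁ D⊑E
    with E' , E₁⇝E' , D'⊑E' , kept' ← lift-Reachable D₁⇝D' D₁⊑E₁ =
    E' , E⇒E₁ ◅ E₁⇝E' , D'⊑E' , λ q off → ≤-trans (kept₁ q off) (kept' q off)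

□-Adj-intro : ∀ {G H} {a c : Fin (n G)} {b d : Fin (n H)} →
  (a ≡ c × Adj H b d) ⊎ (Adj G a c × b ≡ d) → Adj (G □ H) (combine a b) (combine c d)
□-Adj-intro {G} {H} {a} {c} {b} {d} =
  subst₂ PairAdj (sym (remQuot-combine {n G} {n H} a b)) (sym (remQuot-combine {n G} {n H} c d))
  where
  PairAdj : Fin (n G) × Fin (n H) → Fin (n G) × Fin (n H) → Set
  PairAdj (a , b) (c , d) = (a ≡ c × Adj H b d) ⊎ (Adj G a c × b ≡ d)

□-Adj? : ∀ {G H} → (∀ a c → Dec (Adj G a c)) → (∀ b d → Dec (Adj H b d)) →
  ∀ p q → Dec (Adj (G □ H) p q)
□-Adj? {G} {H} G-adj? H-adj? p q =
  let (a , b) = remQuot {n G} (n H) p ; (c , d) = remQuot {n G} (n H) q in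
  ((a ≟ᶠ c) ×-dec H-adj? b d) ⊎-dec (G-adj? a c ×-dec (b ≟ᶠ d))

□-embedˡ : ∀ {G H} → Fin (n H) → Embedding G (G □ H)
□-embedˡ {G} {H} x = record
  { embed           = λ a → combine a x
  ; embed-injective = λ {a} {b} → combine-injectiveˡ a x b x
  ; embed-Adj       = λ a~b → □-Adj-intro {G} {H} (inj₂ (a~b , refl))
  }

□-embedʳ : ∀ {G H} → Fin (n G) → Embedding H (G □ H)
□-embedʳ {G} {H} a = record
  { embed           = combine a
  ; embed-injective = λ {x} {y} → combine-injectiveʳ a x a y
  ; embed-Adj       = λ x~y → □-Adj-intro {G} {H} (inj₁ (refl , x~y))
  }

module Fibrewise {H G : Graph} where
  fibred : (Fin (n G) → Distribution H) → Distribution (H □ G)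
  fibred K p = K (proj₂ (remQuot {n H} (n G) p)) (proj₁ (remQuot {n H} (n G) p))

  fibred-combine : ∀ K a x → fibred K (combine a x) ≡ K x a
  fibred-combine K a x = cong (λ (b , y) → K y b) (remQuot-combine {n H} {n G} a x)

  module _ (K K' : Fin (n G) → Distribution H) (K⇝K' : ∀ x → Reachable H (K x) (K' x)) where
    gather-fibres : (xs : List (Fin (n G))) → Unique xs →
      Σ[ E ∈ Distribution (H □ G) ] Reachable (H □ G) (fibred K) E ×
        (∀ {x} → x ∈ xs → ∀ a → K' x a ≤ E (combine a x)) ×
        (∀ {x} → x ∉ xs → ∀ a → K x a ≤ E (combine a x))
    gather-fibres [] [] = fibred K , ε , (λ ()) , λ _ a → ≤-reflexive (sym (fibred-combine K a _))
    gather-fibres (x ∷ xs) (x≢xs ∷ unique-xs)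
      with E , ⇝E , done , todo ← gather-fibres xs unique-xs
      with E' , E⇝E' , K'x⊑E' , kept ← Lift.lift-Reachable (□-embedˡ {H} {G} x) (K⇝K' x) (todo (All¬⇒¬Any x≢xs)) =
      E' , ⇝E ◅◅ E⇝E' , done' , todo'
      where
      untouched : ∀ {y} → y ≢ x → ∀ a → E (combine a y) ≤ E' (combine a y)
      untouched {y} y≢x a = kept (combine a y) λ b eq → y≢x (sym (combine-injectiveʳ b x a y eq))
      done' : ∀ {y} → y ∈ x ∷ xs → ∀ a → K' y a ≤ E' (combine a y)
      done' (here refl)  = K'x⊑E'
      done' (there y∈xs) a = ≤-trans (done y∈xs a) (untouched (All.lookup x≢xs y∈xs ∘ sym) a)
      todo' : ∀ {y} → y ∉ x ∷ xs → ∀ a → K y a ≤ E' (combine a y)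
      todo' y∉ a = ≤-trans (todo (y∉ ∘ there) a) (untouched (y∉ ∘ here) a)

    fibrewise-Reachable : Σ[ E ∈ Distribution (H □ G) ] Reachable (H □ G) (fibred K) E ×
                            (∀ x a → K' x a ≤ E (combine a x))
    fibrewise-Reachable with E , ⇝E , done , _ ← gather-fibres (allFin (n G)) (allFin⁺ (n G)) =
      E , ⇝E , λ x → done (∈-allFin x)

·-Solvable : ∀ {H G t} (K : Distribution H) (D : Distribution G) →
  (∀ x → Solvable H (D x) (λ a → K a * D x)) → Solvable G t D →
  Solvable (H □ G) t (_·_ {H} {G} K D)
·-Solvable {H} {G} {t} K D K-solvable D-solvable p =
  subst (λ q → Σ[ E ∈ Distribution (H □ G) ] Reachable (H □ G) (_·_ {H} {G} K D) E × t ≤ E q)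
        (combine-remQuot {n H} (n G) p)
        (solve-at (proj₁ (remQuot {n H} (n G) p)) (proj₂ (remQuot {n H} (n G) p)))
  where
  open Fibrewise {H} {G}
  solve-at : ∀ c y → Σ[ E ∈ Distribution (H □ G) ] Reachable (H □ G) (_·_ {H} {G} K D) E × t ≤ E (combine c y)
  solve-at c y
    with E , ⇝E , gathered ← fibrewise-Reachable (λ x a → K a * D x) (λ x → proj₁ (K-solvable x c))
                                                 (λ x → proj₁ (proj₂ (K-solvable x c)))
    with D' , D⇝D' , t≤D'y ← D-solvable y
    with E' , E⇝E' , D'⊑E' , _ ← Lift.lift-Reachable (□-embedʳ {H} {G} c) D⇝D'
                                   (λ x → ≤-trans (proj₂ (proj₂ (K-solvable x c))) (gathered x c)) =
    E' , ⇝E ◅◅ E⇝E' , ≤-trans t≤D'y (D'⊑E' y)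

·-AllMult4 : ∀ {H G} (K : Distribution H) {D : Distribution G} → AllMult4 G D →
  AllMult4 (H □ G) (_·_ {H} {G} K D)
·-AllMult4 {H} {G} K D-mult4 p = ∣n⇒∣m*n (K (proj₁ (remQuot {n H} (n G) p))) (D-mult4 (proj₂ (remQuot {n H} (n G) p)))

sum-map-tabulate : ∀ {m k} (D : Fin k → ℕ) (f : Fin m → Fin k) → List.sum (map D (tabulate f)) ≡ sum (D ∘ f)
sum-map-tabulate {zero}  D f = refl
sum-map-tabulate {suc m} D f = cong (D (f zero) +_) (sum-map-tabulate D (f ∘ suc))

size≡sum : ∀ G (D : Distribution G) → size G D ≡ sum D
size≡sum G D = sum-map-tabulate D (λ i → i)

sum-↑ : ∀ m {k} (f : Fin (m + k) → ℕ) → sum f ≡ sum (f ∘ (_↑ˡ k)) + sum (f ∘ (m ↑ʳ_))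
sum-↑ zero    f = refl
sum-↑ (suc m) f = trans (cong (f zero +_) (sum-↑ m (f ∘ suc))) (sym (+-assoc (f zero) _ _))

sum-combine : ∀ m {k} (f : Fin (m * k) → ℕ) → sum f ≡ ∑[ i < m ] ∑[ j < k ] f (combine i j)
sum-combine zero    f = refl
sum-combine (suc m) {k} f =
  trans (sum-↑ k f) (cong (sum (f ∘ (_↑ˡ (m * k))) +_) (sum-combine m (f ∘ (k ↑ʳ_))))

size-· : ∀ {G H} (K : Distribution G) (D : Distribution H) →
  size (G □ H) (_·_ {G} {H} K D) ≡ size G K * size H D
size-· {G} {H} K D = begin
  size (G □ H) (_·_ {G} {H} K D)                          ≡⟨ size≡sum (G □ H) (_·_ {G} {H} K D) ⟩
  sum (_·_ {G} {H} K D)                                   ≡⟨ sum-combine (n G) (_·_ {G} {H} K D) ⟩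
  ∑[ a < n G ] ∑[ x < n H ] (_·_ {G} {H} K D) (combine a x) ≡⟨ sum-cong-≗ (λ a → sum-cong-≗ (λ x → ·-combine a x)) ⟩
  ∑[ a < n G ] ∑[ x < n H ] (K a * D x)                   ≡⟨ sum-cong-≗ (λ a → sym (*-distribˡ-sum (K a) D)) ⟩
  ∑[ a < n G ] (K a * sum D)                              ≡⟨ sym (*-distribʳ-sum (sum D) K) ⟩
  sum K * sum D                                           ≡⟨ sym (cong₂ _*_ (size≡sum G K) (size≡sum H D)) ⟩
  size G K * size H D                                     ∎
  where
  open ≡-Reasoning
  ·-combine : ∀ a x → (_·_ {G} {H} K D) (combine a x) ≡ K a * D x
  ·-combine a x = cong (λ (b , y) → K b * D y) (remQuot-combine {n G} {n H} a x)

record SpanningEmbedding (G P : Graph) : Set where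
  field
    relabel     : Permutation (n G) (n P)
    relabel-Adj : ∀ {x y} → Adj G x y → Adj P (relabel ⟨$⟩ʳ x) (relabel ⟨$⟩ʳ y)

  embedding : Embedding G P
  embedding = record
    { embed           = relabel ⟨$⟩ʳ_
    ; embed-injective = λ eq → trans (sym (inverseˡ relabel)) (trans (cong (relabel ⟨$⟩ˡ_) eq) (inverseˡ relabel))
    ; embed-Adj       = relabel-Adj
    }

  transport : Distribution G → Distribution P
  transport D q = D (relabel ⟨$⟩ˡ q)

  transport-Solvable : ∀ {t D} → Solvable G t D → Solvable P t (transport D)
  transport-Solvable {t} {D} D-solvable q
    with D' , D⇝D' , t≤D' ← D-solvable (relabel ⟨$⟩ˡ q)
    with E' , E⇝E' , D'⊑E' , _ ← Lift.lift-Reachable embedding D⇝D'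
                                   (λ x → ≤-reflexive (cong D (sym (inverseˡ relabel)))) =
    E' , E⇝E' , subst (λ r → t ≤ E' r) (inverseʳ relabel) (≤-trans t≤D' (D'⊑E' _))

  transport-AllMult4 : ∀ {D} → AllMult4 G D → AllMult4 P (transport D)
  transport-AllMult4 D-mult4 q = D-mult4 (relabel ⟨$⟩ˡ q)

  transport-size : ∀ D → size P (transport D) ≡ size G D
  transport-size D = begin
    size P (transport D)  ≡⟨ size≡sum P (transport D) ⟩
    sum (transport D)     ≡⟨ sum-permute D (flip relabel) ⟨
    sum D                 ≡⟨ size≡sum G D ⟨
    size G D              ∎
    where open ≡-Reasoning

module _ {G H K : Graph} where
  private
    assocʳ : Fin (n G * n H * n K) → Fin (n G * (n H * n K))
    assocʳ p = let (ab , x) = remQuot {n G * n H} (n K) p ; (a , b) = remQuot {n G} (n H) ab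
               in combine a (combine b x)

    assocˡ : Fin (n G * (n H * n K)) → Fin (n G * n H * n K)
    assocˡ q = let (a , bx) = remQuot {n G} (n H * n K) q ; (b , x) = remQuot {n H} (n K) bx
               in combine (combine a b) x

    assocʳ-combine : ∀ a b x → assocʳ (combine (combine a b) x) ≡ combine a (combine b x)
    assocʳ-combine a b x = trans
      (cong (λ (ab , x) → let (a , b) = remQuot {n G} (n H) ab in combine a (combine b x))
            (remQuot-combine {n G * n H} {n K} (combine a b) x))
      (cong (λ (a , b) → combine a (combine b x)) (remQuot-combine {n G} {n H} a b))

    assocˡ-combine : ∀ a b x → assocˡ (combine a (combine b x)) ≡ combine (combine a b) x
    assocˡ-combine a b x = trans
      (cong (λ (a , bx) → let (b , x) = remQuot {n H} (n K) bx in combine (combine a b) x)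
            (remQuot-combine {n G} {n H * n K} a (combine b x)))
      (cong (λ (b , x) → combine (combine a b) x) (remQuot-combine {n H} {n K} b x))

    assocˡ-assocʳ : ∀ p → assocˡ (assocʳ p) ≡ p
    assocˡ-assocʳ p =
      let (ab , x) = remQuot {n G * n H} (n K) p ; (a , b) = remQuot {n G} (n H) ab in begin
      assocˡ (combine a (combine b x))  ≡⟨ assocˡ-combine a b x ⟩
      combine (combine a b) x           ≡⟨ cong (λ ab → combine ab x) (combine-remQuot {n G} (n H) ab) ⟩
      combine ab x                      ≡⟨ combine-remQuot {n G * n H} (n K) p ⟩
      p                                 ∎
      where open ≡-Reasoning

    assocʳ-assocˡ : ∀ q → assocʳ (assocˡ q) ≡ q
    assocʳ-assocˡ q =
      let (a , bx) = remQuot {n G} (n H * n K) q ; (b , x) = remQuot {n H} (n K) bx in begin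
      assocʳ (combine (combine a b) x)  ≡⟨ assocʳ-combine a b x ⟩
      combine a (combine b x)           ≡⟨ cong (combine a) (combine-remQuot {n H} (n K) bx) ⟩
      combine a bx                      ≡⟨ combine-remQuot {n G} (n H * n K) q ⟩
      q                                 ∎
      where open ≡-Reasoning

    assocʳ-Adj : ∀ {p q} → Adj ((G □ H) □ K) p q → Adj (G □ (H □ K)) (assocʳ p) (assocʳ q)
    assocʳ-Adj (inj₁ (ab≡cd , x~y)) =
      □-Adj-intro {G} {H □ K} (inj₁ (cong (proj₁ ∘ remQuot {n G} (n H)) ab≡cd ,
        □-Adj-intro {H} {K} (inj₁ (cong (proj₂ ∘ remQuot {n G} (n H)) ab≡cd , x~y))))
    assocʳ-Adj (inj₂ (inj₁ (a≡c , b~d) , x≡y)) =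
      □-Adj-intro {G} {H □ K} (inj₁ (a≡c , □-Adj-intro {H} {K} (inj₂ (b~d , x≡y))))
    assocʳ-Adj (inj₂ (inj₂ (a~c , b≡d) , x≡y)) =
      □-Adj-intro {G} {H □ K} (inj₂ (a~c , cong₂ combine b≡d x≡y))

  □-assoc : SpanningEmbedding ((G □ H) □ K) (G □ (H □ K))
  □-assoc = record
    { relabel     = permutation assocʳ assocˡ assocʳ-assocˡ assocˡ-assocʳ
    ; relabel-Adj = assocʳ-Adj
    }

C5-Adj? : ∀ i j → Dec (Adj C5 i j)
C5-Adj? i j = (toℕ j ℕ.≟ (toℕ i + 1) % 5) ⊎-dec (toℕ i ℕ.≟ (toℕ j + 1) % 5)

open Moves C5² using (IsFunnel; isFunnel?; funnel-gathers)

record Route : Set where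
  constructor route
  field target b₁ b₂ m₂ b₃ m₃ : Fin 25

FedByB : Route → Set
FedByB (route c b₁ b₂ m₂ b₃ m₃) = B b₁ ≡ 1 × B b₂ ≡ 1 × B b₃ ≡ 1 × IsFunnel c b₁ b₂ m₂ b₃ m₃

fedByB? : ∀ r → Dec (FedByB r)
fedByB? (route c b₁ b₂ m₂ b₃ m₃) =
  (B b₁ ℕ.≟ 1) ×-dec (B b₂ ℕ.≟ 1) ×-dec (B b₃ ℕ.≟ 1) ×-dec
  isFunnel? (□-Adj? {C5} {C5} C5-Adj? C5-Adj?) c b₁ b₂ m₂ b₃ m₃

-- The vertex (vᵢ , vⱼ) of C5² is numbered 5i + j, so B sits on 0, 7, 14, 16, 23.
routes : List Route
routes =
  route (# 1)  (# 0)  (# 7)  (# 2)  (# 16) (# 21) ∷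
  route (# 2)  (# 7)  (# 0)  (# 1)  (# 23) (# 3)  ∷
  route (# 3)  (# 23) (# 7)  (# 2)  (# 0)  (# 4)  ∷
  route (# 4)  (# 0)  (# 23) (# 3)  (# 14) (# 9)  ∷
  route (# 5)  (# 0)  (# 7)  (# 6)  (# 14) (# 9)  ∷
  route (# 6)  (# 7)  (# 0)  (# 1)  (# 16) (# 11) ∷
  route (# 8)  (# 7)  (# 23) (# 3)  (# 14) (# 9)  ∷
  route (# 9)  (# 14) (# 0)  (# 4)  (# 7)  (# 8)  ∷
  route (# 10) (# 14) (# 0)  (# 5)  (# 16) (# 11) ∷
  route (# 11) (# 16) (# 7)  (# 6)  (# 14) (# 10) ∷
  route (# 12) (# 7)  (# 16) (# 11) (# 14) (# 13) ∷
  route (# 13) (# 14) (# 7)  (# 8)  (# 23) (# 18) ∷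
  route (# 15) (# 16) (# 14) (# 10) (# 0)  (# 20) ∷
  route (# 17) (# 16) (# 7)  (# 12) (# 23) (# 18) ∷
  route (# 18) (# 23) (# 14) (# 13) (# 16) (# 17) ∷
  route (# 19) (# 14) (# 16) (# 15) (# 23) (# 18) ∷
  route (# 20) (# 0)  (# 16) (# 15) (# 23) (# 24) ∷
  route (# 21) (# 16) (# 0)  (# 1)  (# 23) (# 22) ∷
  route (# 22) (# 23) (# 7)  (# 2)  (# 16) (# 17) ∷
  route (# 24) (# 23) (# 0)  (# 4)  (# 14) (# 19) ∷ []

-- Abstract: unfolding these decision-procedure certificates makes later type checking blow up.
abstract
  routes-FedByB : All FedByB routes
  routes-FedByB = from-yes (All.all? fedByB? routes)

  C5²-covered : All (λ c → B c ≡ 1 ⊎ c ∈ map Route.target routes) (allFin 25)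
  C5²-covered = from-yes (All.all? (λ c → (B c ℕ.≟ 1) ⊎-dec (c ∈? map Route.target routes)) (allFin 25))

B≡1⇒≤B* : ∀ a s → B a ≡ 1 → s ≤ B a * s
B≡1⇒≤B* a s Ba≡1 = subst (λ k → s ≤ k * s) (sym Ba≡1) (≤-reflexive (sym (*-identityˡ s)))

Gathers : ℕ → Fin 25 → Set
Gathers j c = Σ[ E ∈ Distribution C5² ] Reachable C5² (λ a → B a * (4 * j)) E × 4 * j ≤ E c

route-gathers : ∀ j r → FedByB r → Gathers j (Route.target r)
route-gathers j (route c b₁ b₂ m₂ b₃ m₃) (B₁ , B₂ , B₃ , funnel) =
  funnel-gathers j {m₂ = m₂} {m₃ = m₃} funnel
    (B≡1⇒≤B* b₁ (4 * j) B₁) (B≡1⇒≤B* b₂ (4 * j) B₂) (B≡1⇒≤B* b₃ (4 * j) B₃)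

B-Solvable : ∀ j → Solvable C5² (4 * j) (λ a → B a * (4 * j))
B-Solvable j c with All.lookup C5²-covered (∈-allFin c)
... | inj₁ Bc≡1 = (λ a → B a * (4 * j)) , ε , B≡1⇒≤B* c (4 * j) Bc≡1
... | inj₂ c∈targets =
  let r , r∈routes , c≡target = ∈-map⁻ Route.target {xs = routes} c∈targets in
  subst (Gathers j) (sym c≡target) (route-gathers j r (All.lookup routes-FedByB r∈routes))

B-scaled-Solvable : ∀ {s} → 4 ∣ s → Solvable C5² s (λ a → B a * s)
B-scaled-Solvable (divides j refl) rewrite *-comm j 4 = B-Solvable j

B-product : ∀ G {t} (D : Distribution G) → Solvable G t D → AllMult4 G D →
  Solvable (C5² □ G) t (_·_ {C5²} {G} B D) ×
  AllMult4 (C5² □ G) (_·_ {C5²} {G} B D) ×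
  size (C5² □ G) (_·_ {C5²} {G} B D) ≡ 5 * size G D
B-product G D D-solvable D-mult4 =
  ·-Solvable {C5²} {G} B D (λ x → B-scaled-Solvable (D-mult4 x)) D-solvable ,
  ·-AllMult4 {C5²} {G} B D-mult4 ,
  size-· {C5²} {G} B D

Mult4SolvableOfSize : Graph → ℕ → ℕ → Set
Mult4SolvableOfSize G t s = Σ[ D ∈ Distribution G ] Solvable G t D × AllMult4 G D × size G D ≡ s

C5□C5□-Mult4Solvable : ∀ G {t s} → Mult4SolvableOfSize G t s → Mult4SolvableOfSize (C5 □ (C5 □ G)) t (5 * s)
C5□C5□-Mult4Solvable G (D , D-solvable , D-mult4 , refl) =
  let BD-solvable , BD-mult4 , BD-size = B-product G D D-solvable D-mult4 in
  transport (_·_ {C5²} {G} B D) , transport-Solvable BD-solvable , transport-AllMult4 BD-mult4 ,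
  trans (transport-size (_·_ {C5²} {G} B D)) BD-size
  where open SpanningEmbedding (□-assoc {C5} {C5} {G})

powBox-Mult4Solvable : ∀ G {t} (D : Distribution G) → Solvable G t D → AllMult4 G D →
  ∀ m → Mult4SolvableOfSize (powBox C5 (2 * m) G) t (5 ^ m * size G D)
powBox-Mult4Solvable G D D-solvable D-mult4 zero = D , D-solvable , D-mult4 , sym (*-identityˡ (size G D))
powBox-Mult4Solvable G {t} D D-solvable D-mult4 (suc m) =
  subst₂ (λ k s → Mult4SolvableOfSize (powBox C5 k G) t s) (sym (*-suc 2 m)) (sym (*-assoc 5 (5 ^ m) (size G D)))
    (C5□C5□-Mult4Solvable (powBox C5 (2 * m) G) (powBox-Mult4Solvable G D D-solvable D-mult4 m))

theorem5p2 : (G : Graph) (t : ℕ) (D : Distribution G) →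
    1 ≤ t → Solvable G t D → AllMult4 G D →
    (Solvable (C5² □ G) t (_·_ {C5²} {G} B D) ×
     AllMult4 (C5² □ G) (_·_ {C5²} {G} B D) ×
     size (C5² □ G) (_·_ {C5²} {G} B D) ≡ 5 * size G D) ×
    (∀ (m k : ℕ) → IsOptimalPebblingNumber (powBox C5 (2 * m) G) t k →
      k ≤ 5 ^ m * size G D)
theorem5p2 G t D _ D-solvable D-mult4 = B-product G D D-solvable D-mult4 , optimal-bound
  where
  optimal-bound : ∀ m k → IsOptimalPebblingNumber (powBox C5 (2 * m) G) t k → k ≤ 5 ^ m * size G D
  optimal-bound m k (_ , k-minimal) =
    let D' , D'-solvable , _ , size≡ = powBox-Mult4Solvable G D D-solvable D-mult4 m in
    subst (k ≤_) size≡ (k-minimal D' D'-solvable)
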